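{- Let $(f_d)_{d\ge 0}$ be the Fibonacci-type sequence defined by $f_0=1$, $f_1=1$ and $f_d=f_{d-1}+f_{d-2}$ for $d\ge 2$, and set $f_{ -1}=0$. Call an integer partition a basal billiard partition if its parts are distinct, its smallest part equals $2$, no two adjacent parts (in the ordering by size) are both odd, and the difference between any two adjacent parts is at most $2$. Then for every integer $d\ge 1$: (a) there are exactly $f_d$ basal billiard partitions with $d$ parts; (b) there are exactly $f_{d-1}$ basal billiard partitions with $d$ parts whose largest part is even; (c) there are exactly $f_{d-2}$ basal billiard partitions with $d$ parts whose largest part is odd.
   Context: Partitions are written as $m_1<m_2<\dots<m_d$ (distinct positive parts); "adjacent parts" means $m_i,m_{i+1}$ for some $i$. -}

module Defs where

open import Data.Nat using (ℕ; zero; suc; _+_; _∸_; _≤_; _<_)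
open import Data.Nat.Divisibility using (_∣_)
open import Data.List using (List; head; last; length)
open import Data.List.Relation.Unary.Linked using (Linked)
open import Data.List.Relation.Unary.Unique.Propositional using (Unique)
open import Data.List.Membership.Propositional using (_∈_)
open import Data.Maybe using (Maybe; just)
open import Data.Product using (Σ; ∃; _×_)
open import Function.Bundles using (_⇔_)
open import Relation.Nullary using (¬_)
open import Relation.Binary.PropositionalEquality using (_≡_)

f : ℕ → ℕ
f zero = 1
f (suc zero) = 1
f (suc (suc d)) = f (suc d) + f d

fPrev : ℕ → ℕ
fPrev zero = 0
fPrev (suc d) = f d

Even : ℕ → Set
Even n = 2 ∣ n

Odd : ℕ → Set
Odd n = ¬ Even n

-- A partition into distinct parts is represented by the strictly
-- increasing list of its parts m₁ < m₂ < … < m_d.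
BasalBilliard : List ℕ → Set
BasalBilliard xs =
  Linked _<_ xs
  × head xs ≡ just 2
  × Linked (λ a b → ¬ (Odd a × Odd b)) xs
  × Linked (λ a b → b ∸ a ≤ 2) xs

HasCount : (List ℕ → Set) → ℕ → Set
HasCount P n =
  Σ (List (List ℕ)) λ L → Unique L × (∀ xs → (xs ∈ L) ⇔ P xs) × length L ≡ n

BasalWithParts : ℕ → List ℕ → Set
BasalWithParts d xs = BasalBilliard xs × length xs ≡ d

LargestEven : List ℕ → Set
LargestEven xs = ∃ λ m → last xs ≡ just m × Even m

LargestOdd : List ℕ → Set
LargestOdd xs = ∃ λ m → last xs ≡ just m × Odd m

{-# OPTIONS --safe #-}
module Submission where

-- Consecutive parts of a basal partition climb by 1, or by 2 from an even part: a climb of 2 from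
-- an odd part would join two odd parts. Split an ascent from an even part a by its first step.
-- Going to a + 2 leaves an ascent from the even part a + 2 with one part fewer; going to a + 1,
-- which is odd, forces the next part to be a + 2 and leaves two parts fewer. So each count obeys
-- the Fibonacci recursion, and the parity of the largest part only enters through the ascents
-- with zero or one further part.

open import Defs
open import Data.Nat using (ℕ; zero; suc; _+_; _≤_; _<_; _∸_; z≤n; s≤s)
open import Data.Nat.Properties using (suc-injective; n<1+n; n≤1+n; 1+n≢n; ≤-reflexive; ≤-trans; m+n∸n≡m)
open import Data.Nat.Divisibility using (_∣?_; _∣0; ∣-refl; ∣1⇒≡1; ∣m∣n⇒∣m+n; ∣m+n∣m⇒∣n)
open import Data.Product using (_×_; _,_; ∃; proj₁)
open import Data.Sum using (_⊎_; inj₁; inj₂)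
open import Data.Unit using (⊤; tt)
open import Data.Empty using (⊥; ⊥-elim)
open import Data.List using (List; []; _∷_; _++_; map; length; last)
open import Data.List.Properties using (∷-injectiveʳ; length-map; length-++)
open import Data.List.Relation.Unary.Linked as Linked using (Linked; [-]; _∷_)
open import Data.List.Relation.Unary.All using ([])
open import Data.List.Relation.Unary.AllPairs using ([]; _∷_)
open import Data.List.Relation.Unary.Unique.Propositional.Properties as Unique using ()
open import Data.List.Relation.Unary.Any using (here)
open import Data.List.Membership.Propositional using (_∈_)
open import Data.List.Membership.Propositional.Properties using (∈-map⁺; ∈-map⁻; ∈-++⁺ˡ; ∈-++⁺ʳ; ∈-++⁻)
open import Data.Maybe using (just)
open import Function using (_∘_)
open import Function.Bundles using (_⇔_; mk⇔; Equivalence)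
open import Function.Construct.Symmetry using (⇔-sym)
open import Function.Construct.Composition using (_⇔-∘_)
open import Relation.Nullary using (¬_)
open import Relation.Nullary.Decidable using (decidable-stable)
open import Relation.Binary.PropositionalEquality using (_≡_; refl; sym; trans; cong; cong₂; subst)

open Equivalence using (to; from)

even-+2 : ∀ {n} → Even n → Even (2 + n)
even-+2 = ∣m∣n⇒∣m+n ∣-refl

even-∸2 : ∀ {n} → Even (2 + n) → Even n
even-∸2 e = ∣m+n∣m⇒∣n e ∣-refl

odd-+2 : ∀ {n} → Odd n → Odd (2 + n)
odd-+2 o = o ∘ even-∸2

odd⇒even-suc : ∀ {n} → Odd n → Even (suc n)
odd⇒even-suc {zero}        o = ⊥-elim (o (2 ∣0))
odd⇒even-suc {suc zero}    _ = ∣-refl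
odd⇒even-suc {suc (suc n)} o = even-+2 (odd⇒even-suc (o ∘ even-+2))

even⇒odd-suc : ∀ {n} → Even n → Odd (suc n)
even⇒odd-suc {zero}        _ e₁ with () ← ∣1⇒≡1 e₁
even⇒odd-suc {suc zero}    e₁   with () ← ∣1⇒≡1 e₁
even⇒odd-suc {suc (suc n)} e    = odd-+2 (even⇒odd-suc (even-∸2 e))

data Step : ℕ → ℕ → Set where
  +1 : ∀ {a} → Step a (suc a)
  +2 : ∀ {a} → Even a → Step a (2 + a)

Admissible : ℕ → ℕ → Set
Admissible a b = a < b × ¬ (Odd a × Odd b) × b ∸ a ≤ 2

gap-1-or-2 : ∀ {a b} → a < b → b ∸ a ≤ 2 → b ≡ suc a ⊎ b ≡ 2 + a
gap-1-or-2 {zero} {suc zero}          _         _               = inj₁ refl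
gap-1-or-2 {zero} {suc (suc zero)}    _         _               = inj₂ refl
gap-1-or-2 {zero} {suc (suc (suc _))} _         (s≤s (s≤s ()))
gap-1-or-2 {suc a} {suc b}            (s≤s a<b) gap with gap-1-or-2 a<b gap
... | inj₁ refl = inj₁ refl
... | inj₂ refl = inj₂ refl

admissible⇔step : ∀ {a b} → Admissible a b ⇔ Step a b
admissible⇔step = mk⇔ admissible⇒step step⇒admissible
  where
  admissible⇒step : ∀ {a b} → Admissible a b → Step a b
  admissible⇒step {a} (a<b , notBothOdd , gap) with gap-1-or-2 a<b gap
  ... | inj₁ refl = +1
  ... | inj₂ refl = +2 (decidable-stable (2 ∣? a) λ odd → notBothOdd (odd , odd-+2 odd))

  step⇒admissible : ∀ {a b} → Step a b → Admissible a b
  step⇒admissible {a} +1 =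
    n<1+n a , (λ (odd , odd-suc) → odd-suc (odd⇒even-suc odd)) ,
    ≤-trans (≤-reflexive (m+n∸n≡m 1 a)) (s≤s z≤n)
  step⇒admissible {a} (+2 even) =
    s≤s (n≤1+n a) , (λ (odd , _) → odd even) , ≤-reflexive (m+n∸n≡m 2 a)

basal⇔steps : ∀ x ys → BasalBilliard (x ∷ ys) ⇔ (x ≡ 2 × Linked Step (x ∷ ys))
basal⇔steps x ys = mk⇔ basal⇒steps steps⇒basal
  where
  basal⇒steps : BasalBilliard (x ∷ ys) → x ≡ 2 × Linked Step (x ∷ ys)
  basal⇒steps (increasing , refl , notBothOdd , gaps) =
    refl , Linked.map (to admissible⇔step) (Linked.zip (increasing , Linked.zip (notBothOdd , gaps)))

  steps⇒basal : x ≡ 2 × Linked Step (x ∷ ys) → BasalBilliard (x ∷ ys)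
  steps⇒basal (refl , steps) with Linked.unzipWith (from admissible⇔step) steps
  ... | increasing , rest with Linked.unzip rest
  ...   | notBothOdd , gaps = increasing , refl , notBothOdd , gaps

HasCount-resp-⇔ : ∀ {P Q n} → (∀ xs → P xs ⇔ Q xs) → HasCount P n → HasCount Q n
HasCount-resp-⇔ P⇔Q (L , unique , members , len) = L , unique , (λ xs → P⇔Q xs ⇔-∘ members xs) , len

HasCount-∅ : ∀ {P} → (∀ xs → ¬ P xs) → HasCount P 0
HasCount-∅ ¬P = [] , [] , (λ xs → mk⇔ (λ ()) (⊥-elim ∘ ¬P xs)) , refl

HasCount-singleton : ∀ {P} x → (∀ xs → P xs ⇔ xs ≡ x) → HasCount P 1
HasCount-singleton {P} x P⇔≡x =
  x ∷ [] , [] ∷ [] , (λ xs → mk⇔ (member⇒P xs) (λ p → here (to (P⇔≡x xs) p))) , refl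
  where
  member⇒P : ∀ xs → xs ∈ x ∷ [] → P xs
  member⇒P xs (here refl) = from (P⇔≡x xs) refl

HasCount-⊎ : ∀ {P Q m n} → (∀ {xs} → P xs → ¬ Q xs) → HasCount P m → HasCount Q n →
             HasCount (λ xs → P xs ⊎ Q xs) (m + n)
HasCount-⊎ {P} {Q} P∩Q=∅ (L , uniqueL , inL , lenL) (M , uniqueM , inM , lenM) =
  L ++ M , Unique.++⁺ uniqueL uniqueM disjoint , (λ xs → mk⇔ (member⇒P⊎Q xs) (P⊎Q⇒member xs)) ,
  trans (length-++ L) (cong₂ _+_ lenL lenM)
  where
  disjoint : ∀ {xs} → ¬ (xs ∈ L × xs ∈ M)
  disjoint {xs} (∈L , ∈M) = P∩Q=∅ (to (inL xs) ∈L) (to (inM xs) ∈M)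

  member⇒P⊎Q : ∀ xs → xs ∈ L ++ M → P xs ⊎ Q xs
  member⇒P⊎Q xs ∈L++M with ∈-++⁻ L ∈L++M
  ... | inj₁ ∈L = inj₁ (to (inL xs) ∈L)
  ... | inj₂ ∈M = inj₂ (to (inM xs) ∈M)

  P⊎Q⇒member : ∀ xs → P xs ⊎ Q xs → xs ∈ L ++ M
  P⊎Q⇒member xs (inj₁ p) = ∈-++⁺ˡ (from (inL xs) p)
  P⊎Q⇒member xs (inj₂ q) = ∈-++⁺ʳ L (from (inM xs) q)

infixr 5 _∷ᴾ_

_∷ᴾ_ : ℕ → (List ℕ → Set) → List ℕ → Set
(a ∷ᴾ P) []       = ⊥
(a ∷ᴾ P) (b ∷ ys) = b ≡ a × P ys

HasCount-∷ : ∀ {P n} a → HasCount P n → HasCount (a ∷ᴾ P) n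
HasCount-∷ {P} a (L , unique , members , len) =
  map (a ∷_) L , Unique.map⁺ ∷-injectiveʳ unique , (λ xs → mk⇔ (member⇒∷ᴾ xs) (∷ᴾ⇒member xs)) ,
  trans (length-map (a ∷_) L) len
  where
  member⇒∷ᴾ : ∀ xs → xs ∈ map (a ∷_) L → (a ∷ᴾ P) xs
  member⇒∷ᴾ xs ∈aL with ∈-map⁻ (a ∷_) ∈aL
  ... | ys , ∈L , refl = refl , to (members ys) ∈L

  ∷ᴾ⇒member : ∀ xs → (a ∷ᴾ P) xs → xs ∈ map (a ∷_) L
  ∷ᴾ⇒member (b ∷ ys) (refl , p) = ∈-map⁺ (a ∷_) (from (members ys) p)

LastSatisfies : (ℕ → Set) → List ℕ → Set
LastSatisfies P xs = ∃ λ m → last xs ≡ just m × P m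

Ascent : (ℕ → Set) → ℕ → ℕ → List ℕ → Set
Ascent P a n ys = Linked Step (a ∷ ys) × length ys ≡ n × LastSatisfies P (a ∷ ys)

module _ {P : ℕ → Set} where

  ascent₀-count : ∀ {a} → P a → HasCount (Ascent P a 0) 1
  ascent₀-count {a} pa =
    HasCount-singleton [] λ ys → mk⇔ empty (λ { refl → [-] , refl , a , refl , pa })
    where
    empty : ∀ {ys} → Ascent P a 0 ys → ys ≡ []
    empty {[]} _ = refl

  ascent₀-none : ∀ {a} → ¬ P a → HasCount (Ascent P a 0) 0
  ascent₀-none ¬pa = HasCount-∅ λ { [] (_ , _ , _ , refl , pa) → ¬pa pa }

  ascent-from-even⇔ : ∀ {a n} → Even a → ∀ xs →
    Ascent P a (suc n) xs ⇔ ((2 + a ∷ᴾ Ascent P (2 + a) n) xs ⊎ (suc a ∷ᴾ Ascent P (suc a) n) xs)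
  ascent-from-even⇔ {a} {n} even xs = mk⇔ (split xs) (join xs)
    where
    Successors : List ℕ → Set
    Successors xs = (2 + a ∷ᴾ Ascent P (2 + a) n) xs ⊎ (suc a ∷ᴾ Ascent P (suc a) n) xs

    split : ∀ xs → Ascent P a (suc n) xs → Successors xs
    split (_ ∷ _) (+1   ∷ steps , len , last) = inj₂ (refl , steps , suc-injective len , last)
    split (_ ∷ _) (+2 _ ∷ steps , len , last) = inj₁ (refl , steps , suc-injective len , last)

    join : ∀ xs → Successors xs → Ascent P a (suc n) xs
    join (_ ∷ _) (inj₁ (refl , steps , len , last)) = +2 even ∷ steps , cong suc len , last
    join (_ ∷ _) (inj₂ (refl , steps , len , last)) = +1 ∷ steps , cong suc len , last

  ascent-from-odd⇔ : ∀ {a n} → Odd a → ∀ xs →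
    Ascent P a (suc n) xs ⇔ (suc a ∷ᴾ Ascent P (suc a) n) xs
  ascent-from-odd⇔ {a} {n} odd xs = mk⇔ (split xs) (join xs)
    where
    split : ∀ xs → Ascent P a (suc n) xs → (suc a ∷ᴾ Ascent P (suc a) n) xs
    split (_ ∷ _) (+1      ∷ steps , len , last) = refl , steps , suc-injective len , last
    split (_ ∷ _) (+2 even ∷ _     , _)          = ⊥-elim (odd even)

    join : ∀ xs → (suc a ∷ᴾ Ascent P (suc a) n) xs → Ascent P a (suc n) xs
    join (_ ∷ _) (refl , steps , len , last) = +1 ∷ steps , cong suc len , last

  ascent-from-even-count : ∀ {a n k l} → Even a →
    HasCount (Ascent P (2 + a) n) k → HasCount (Ascent P (suc a) n) l →
    HasCount (Ascent P a (suc n)) (k + l)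
  ascent-from-even-count {a} even countₖ countₗ =
    HasCount-resp-⇔ (λ xs → ⇔-sym (ascent-from-even⇔ even xs))
      (HasCount-⊎ distinct-heads (HasCount-∷ (2 + a) countₖ) (HasCount-∷ (suc a) countₗ))
    where
    distinct-heads : ∀ {Q R : List ℕ → Set} {xs} → (2 + a ∷ᴾ Q) xs → ¬ (suc a ∷ᴾ R) xs
    distinct-heads {xs = _ ∷ _} (refl , _) (2+a≡1+a , _) = 1+n≢n 2+a≡1+a

  ascent-from-odd-count : ∀ {a n l} → Odd a →
    HasCount (Ascent P (suc a) n) l → HasCount (Ascent P a (suc n)) l
  ascent-from-odd-count {a} odd count =
    HasCount-resp-⇔ (λ xs → ⇔-sym (ascent-from-odd⇔ odd xs)) (HasCount-∷ (suc a) count)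

  ascent-count : (g : ℕ → ℕ) → (∀ n → g (2 + n) ≡ g (1 + n) + g n) →
    (∀ {a} → Even a → HasCount (Ascent P a 0) (g 0)) →
    (∀ {a} → Even a → HasCount (Ascent P a 1) (g 1)) →
    ∀ {a} → Even a → ∀ n → HasCount (Ascent P a n) (g n)
  ascent-count g g-rec count₀ count₁ even zero          = count₀ even
  ascent-count g g-rec count₀ count₁ even (suc zero)    = count₁ even
  ascent-count g g-rec count₀ count₁ {a} even (suc (suc n)) =
    subst (HasCount _) (sym (g-rec n))
      (ascent-from-even-count even (count (suc n)) (ascent-from-odd-count (even⇒odd-suc even) (count n)))
    where
    count : ∀ m → HasCount (Ascent P (2 + a) m) (g m)
    count = ascent-count g g-rec count₀ count₁ (even-+2 even)

fPrev-rec : ∀ n → fPrev (2 + n) ≡ fPrev (1 + n) + fPrev n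
fPrev-rec zero    = refl
fPrev-rec (suc n) = refl

ascents-count : ∀ {a} → Even a → ∀ n → HasCount (Ascent (λ _ → ⊤) a n) (f (suc n))
ascents-count = ascent-count (f ∘ suc) (λ _ → refl) (λ _ → ascent₀-count tt)
  (λ even → ascent-from-even-count even (ascent₀-count tt) (ascent₀-count tt))

ascents-ending-even-count : ∀ {a} → Even a → ∀ n → HasCount (Ascent Even a n) (f n)
ascents-ending-even-count = ascent-count f (λ _ → refl) ascent₀-count
  (λ even → ascent-from-even-count even
    (ascent₀-count (even-+2 even)) (ascent₀-none (even⇒odd-suc even)))

ascents-ending-odd-count : ∀ {a} → Even a → ∀ n → HasCount (Ascent Odd a n) (fPrev n)
ascents-ending-odd-count = ascent-count fPrev fPrev-rec (λ even → ascent₀-none (λ odd → odd even))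
  (λ even → ascent-from-even-count even
    (ascent₀-none (λ odd → odd (even-+2 even))) (ascent₀-count (even⇒odd-suc even)))

basal⇔2∷ascent : ∀ {P n} xs →
  (2 ∷ᴾ Ascent P 2 n) xs ⇔ (BasalWithParts (suc n) xs × LastSatisfies P xs)
basal⇔2∷ascent {P} {n} xs = mk⇔ (ascent⇒basal xs) (basal⇒ascent xs)
  where
  ascent⇒basal : ∀ xs → (2 ∷ᴾ Ascent P 2 n) xs → BasalWithParts (suc n) xs × LastSatisfies P xs
  ascent⇒basal (_ ∷ ys) (refl , steps , len , last) =
    (from (basal⇔steps 2 ys) (refl , steps) , cong suc len) , last

  basal⇒ascent : ∀ xs → BasalWithParts (suc n) xs × LastSatisfies P xs → (2 ∷ᴾ Ascent P 2 n) xs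
  basal⇒ascent (x ∷ ys) ((basal , len) , last) with to (basal⇔steps x ys) basal
  ... | refl , steps = refl , steps , suc-injective len , last

basal-count : ∀ {P n k} → HasCount (Ascent P 2 n) k →
  HasCount (λ xs → BasalWithParts (suc n) xs × LastSatisfies P xs) k
basal-count = HasCount-resp-⇔ basal⇔2∷ascent ∘ HasCount-∷ 2

last-defined : ∀ {A : Set} (x : A) ys → ∃ λ y → last (x ∷ ys) ≡ just y
last-defined x []       = x , refl
last-defined x (y ∷ ys) = last-defined y ys

theorem3p1 : (d : ℕ) → 1 ≤ d →
    HasCount (BasalWithParts d) (f d)
    × HasCount (λ xs → BasalWithParts d xs × LargestEven xs) (fPrev d)
    × HasCount (λ xs → BasalWithParts d xs × LargestOdd xs) (fPrev (d ∸ 1))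
theorem3p1 (suc n) _ =
    HasCount-resp-⇔ (λ xs → mk⇔ proj₁ (λ basal → basal , has-last xs basal))
      (basal-count (ascents-count even-2 n))
  , basal-count (ascents-ending-even-count even-2 n)
  , basal-count (ascents-ending-odd-count even-2 n)
  where
  even-2 : Even 2
  even-2 = ∣-refl

  has-last : ∀ xs → BasalWithParts (suc n) xs → LastSatisfies (λ _ → ⊤) xs
  has-last (x ∷ ys) _ = let m , last≡m = last-defined x ys in m , last≡m , tt
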